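{- Let $\Gamma$ be a finite group acting on $[n]$, and let $T\subseteq\Gamma$ be a generating set with $e\notin T$, $T=T^{ -1}$, closed under conjugation. Let $m=\max_{\tau\in T}|\mathrm{supp}(\tau)|$ and suppose the action is $(m+a)$-transitive with $a\geq2$. Let $T_0=T$, $T_k=\{\tau\in T:\{1,\ldots,k\}\subseteq\mathrm{supp}(\tau)\}$ and $R_k=T_{k-1}\cap\Gamma_k$ for $k\geq1$. Let $\Gamma^{(0)}=\Gamma$ and $\Gamma^{(i)}$ be the pointwise stabilizer of $\{n-i+1,\ldots,n\}$ for $1\leq i\leq a-1$. Define $G_{k,i}=\mathrm{Cay}(\Gamma^{(i)},T_k\cap\Gamma^{(i)})$ and $H_{k,i}=\mathrm{Cay}(\Gamma^{(i)}\cap\Gamma_k,R_k\cap\Gamma^{(i)})$. Then for $0\leq i\leq a-2$ and $0\leq k\leq m-1$, $H_{k+1,i}\cong G_{k,i+1}$.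
   Context: Right action convention $x^{\gamma\delta}=(x^\gamma)^\delta$; $\Gamma_k$ is the stabilizer of $k$; $\mathrm{supp}(\tau)$ is the set of points moved by $\tau$. $\mathrm{Cay}(\Delta,S)$ has vertex set $\Delta$ and edges $\{\delta,s\delta\}$, $\delta\in\Delta,s\in S$. $s$-transitivity: any $s$-tuple of distinct points can be mapped to any other such tuple. -}

module Defs where

open import Level using (Level; _⊔_) renaming (suc to lsuc; zero to lzero)
open import Algebra.Bundles using (Group)
open import Data.Nat using (ℕ; zero; suc; _≤_; _<_; _∸_)
open import Data.Fin using (Fin; toℕ) renaming (_≟_ to _≟ᶠ_)
open import Data.List using (List; foldr; length; filter)
open import Data.List.Relation.Unary.All using (All)
open import Data.List.Relation.Unary.Any using (Any)
open import Data.Fin.Base using ()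
open import Data.List.Base using ()
open import Data.Product using (Σ; ∃; _×_; proj₁)
open import Data.Sum using (_⊎_)
open import Relation.Nullary using (¬_; ¬?)
open import Relation.Unary using (Pred; _∩_)
open import Relation.Binary.PropositionalEquality using (_≡_)
open import Function.Definitions using (Injective)
import Data.List as L

-- all elements of Fin n (indices 0..n-1 represent the points 1..n)
allPoints : (n : ℕ) → List (Fin n)
allPoints n = L.allFin n

module GroupAction {c ℓ : Level} (Γ : Group c ℓ) (n : ℕ) where
  open Group Γ

  Finite : Set (c ⊔ ℓ)
  Finite = Σ (List Carrier) λ xs → ∀ g → Any (g ≈_) xs

  -- a right action of Γ on [n] (point j ∈ [n] is represented by Fin index j-1):
  -- x^(gh) = (x^g)^h
  record RightAction : Set (c ⊔ ℓ) where
    field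
      act    : Fin n → Carrier → Fin n
      act-cong : ∀ x {g h} → g ≈ h → act x g ≡ act x h
      act-ε  : ∀ x → act x ε ≡ x
      act-∙  : ∀ x g h → act x (g ∙ h) ≡ act (act x g) h

  record IsSymConjGenSet {p : Level} (T : Pred Carrier p) : Set (c ⊔ ℓ ⊔ p) where
    field
      resp     : ∀ {x y} → x ≈ y → T x → T y
      no-ε     : ¬ T ε
      inv      : ∀ {τ} → T τ → T (τ ⁻¹)
      conj     : ∀ {τ} g → T τ → T ((g ⁻¹ ∙ τ) ∙ g)
      generate : ∀ g → Σ (List Carrier) λ ws → All T ws × (g ≈ foldr _∙_ ε ws)

  Adj : ∀ {p} → Pred Carrier p → Carrier → Carrier → Set (c ⊔ ℓ ⊔ p)
  Adj S x y = (Σ Carrier λ s → S s × (y ≈ s ∙ x)) ⊎ (Σ Carrier λ s → S s × (x ≈ s ∙ y))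

  record CayIso {q₁ p₁ q₂ p₂ : Level}
                (Δ₁ : Pred Carrier q₁) (S₁ : Pred Carrier p₁)
                (Δ₂ : Pred Carrier q₂) (S₂ : Pred Carrier p₂)
                : Set (c ⊔ ℓ ⊔ q₁ ⊔ p₁ ⊔ q₂ ⊔ p₂) where
    field
      to      : Σ Carrier Δ₁ → Σ Carrier Δ₂
      from    : Σ Carrier Δ₂ → Σ Carrier Δ₁
      to-cong : ∀ x y → proj₁ x ≈ proj₁ y → proj₁ (to x) ≈ proj₁ (to y)
      from-cong : ∀ x y → proj₁ x ≈ proj₁ y → proj₁ (from x) ≈ proj₁ (from y)
      from-to : ∀ x → proj₁ (from (to x)) ≈ proj₁ x
      to-from : ∀ y → proj₁ (to (from y)) ≈ proj₁ y
      adj-to  : ∀ x y → Adj S₁ (proj₁ x) (proj₁ y) → Adj S₂ (proj₁ (to x)) (proj₁ (to y))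
      adj-from : ∀ x y → Adj S₂ (proj₁ (to x)) (proj₁ (to y)) → Adj S₁ (proj₁ x) (proj₁ y)

  module WithAction (A : RightAction) where
    open RightAction A

    suppSize : Carrier → ℕ
    suppSize τ = length (filter (λ x → ¬? (act x τ ≟ᶠ x)) (allPoints n))

    IsMaxSupp : ∀ {p} → Pred Carrier p → ℕ → Set (c ⊔ p)
    IsMaxSupp T m = (∀ τ → T τ → suppSize τ ≤ m) × (Σ Carrier λ τ → T τ × suppSize τ ≡ m)

    Transitive : ℕ → Set c
    Transitive s = s ≤ n ×
      (∀ (u v : Fin s → Fin n) → Injective _≡_ _≡_ u → Injective _≡_ _≡_ v →
         Σ Carrier λ g → ∀ j → act (u j) g ≡ v j)

    -- T_k = {τ ∈ T : {1,…,k} ⊆ supp τ}  (points 1..k = indices 0..k-1)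
    Tk : ∀ {p} → Pred Carrier p → ℕ → Pred Carrier p
    Tk T k τ = T τ × (∀ x → toℕ x < k → ¬ (act x τ ≡ x))

    -- Γ_{j+1}: stabilizer of the point j+1 (Fin index j)
    StabPt : ℕ → Pred Carrier lzero
    StabPt j g = ∀ x → toℕ x ≡ j → act x g ≡ x

    -- Γ^{(i)}: pointwise stabilizer of {n-i+1,…,n} (indices n-i..n-1)
    Γsup : ℕ → Pred Carrier lzero
    Γsup i g = ∀ x → n ∸ i ≤ toℕ x → act x g ≡ x

    -- R_{k+1} = T_k ∩ Γ_{k+1}
    Rsuc : ∀ {p} → Pred Carrier p → ℕ → Pred Carrier p
    Rsuc T k = Tk T k ∩ StabPt k

    -- H≅G T k₁ i₁ k₂ i₂  means  H_{k₁+1,i₁} ≅ G_{k₂,i₂}, where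
    -- G_{k,i} = Cay(Γ^{(i)}, T_k ∩ Γ^{(i)})
    -- H_{k+1,i} = Cay(Γ^{(i)} ∩ Γ_{k+1}, R_{k+1} ∩ Γ^{(i)})
    H≅G : ∀ {p} → Pred Carrier p → ℕ → ℕ → ℕ → ℕ → Set (c ⊔ ℓ ⊔ p)
    H≅G T k₁ i₁ k₂ i₂ =
      CayIso (Γsup i₁ ∩ StabPt k₁) (Rsuc T k₁ ∩ Γsup i₁)
             (Γsup i₂) (Tk T k₂ ∩ Γsup i₂)

-- Conjugation h ↦ g⁻¹hg is an automorphism of Γ, hence an isomorphism
-- Cay(Δ, S) ≅ Cay(Δ', S') whenever it maps Δ onto Δ' and S onto S'.
-- Since k + i + 2 ≤ m + a, transitivity provides g fixing 1, …, k and
-- n-i+1, …, n and sending k+1 to n-i. As h fixes y iff g⁻¹hg fixes y^g,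
-- conjugation by g maps Γ^(i) ∩ Γ_(k+1) onto Γ^(i+1), and it maps T_k onto
-- itself because T is conjugation invariant and g fixes 1, …, k.
module Submission where

open import Defs
open import Level using (Level; _⊔_)
open import Algebra.Bundles using (Group)
open import Data.Nat using (ℕ; zero; suc; _+_; _∸_; _≤_; _<_; _≤?_; z≤n; z<s)

open import Algebra.Properties.Group using (⁻¹-anti-homo-∙; ε⁻¹≈ε)
open import Data.Nat.Properties
open import Data.Fin using (Fin; toℕ; fromℕ<) renaming (_≟_ to _≟ᶠ_)
open import Data.Fin.Properties using (toℕ-fromℕ<; toℕ-injective; toℕ<n)
open import Data.Fin.Permutation.Components using (transpose; transpose-inverse)
open import Data.Product using (Σ; _×_; _,_; proj₁; proj₂)
open import Data.Sum using (_⊎_; inj₁; inj₂)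
import Data.Sum as Sum
open import Function using (_∘_; _⇔_; mk⇔; Equivalence)
open import Function.Definitions using (Injective)
open import Relation.Binary.Definitions using (_Respects_)
open import Relation.Binary.PropositionalEquality
  using (_≡_; _≢_; ≢-sym; refl; sym; trans; cong; subst; module ≡-Reasoning)
open import Relation.Nullary using (yes; no; contradiction)
open import Relation.Nullary.Decidable using (dec-true; dec-false)
open import Relation.Unary using (Pred; _∩_; _⊆_; _≐_)
import Relation.Binary.Reasoning.Setoid as SetoidReasoning
open import Tactic.MonoidSolver using (solve)

open Equivalence using (to; from)

∸-suc-≤-split : ∀ n i {j} → n ∸ suc i ≤ j → n ∸ i ≤ j ⊎ j ≡ n ∸ suc i
∸-suc-≤-split zero    zero    _   = inj₁ z≤n
∸-suc-≤-split zero    (suc i) _   = inj₁ z≤n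
∸-suc-≤-split (suc n) zero    n≤j = Sum.map₂ sym (m≤n⇒m<n∨m≡n n≤j)
∸-suc-≤-split (suc n) (suc i) p   = ∸-suc-≤-split n i p

m+suc[n]≤o⇒m<o∸n : ∀ m n {o} → m + suc n ≤ o → m < o ∸ n
m+suc[n]≤o⇒m<o∸n m n {o} p = m+n≤o⇒m≤o∸n (suc m) (subst (_≤ o) (+-suc m n) p)

m∸n≤o⇒m+p∸o≤p+n : ∀ m n o p → m ∸ n ≤ o → m + p ∸ o ≤ p + n
m∸n≤o⇒m+p∸o≤p+n m n o p m∸n≤o = m≤n+o⇒m∸n≤o (m + p) o (begin
  m + p             ≤⟨ +-monoˡ-≤ p (≤-trans (m≤n+m∸n m n) (+-monoʳ-≤ n m∸n≤o)) ⟩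
  n + o + p         ≡⟨ cong (_+ p) (+-comm n o) ⟩
  o + n + p         ≡⟨ +-assoc o n p ⟩
  o + (n + p)       ≡⟨ cong (o +_) (+-comm n p) ⟩
  o + (p + n)       ∎)
  where open ≤-Reasoning

reflectAbove : ℕ → ℕ → ℕ → ℕ
reflectAbove n k j with j ≤? k
... | yes _ = j
... | no  _ = n + k ∸ j

module _ {n k : ℕ} where

  reflectAbove-≤ : ∀ {j} → j ≤ k → reflectAbove n k j ≡ j
  reflectAbove-≤ {j} j≤k with j ≤? k
  ... | yes _   = refl
  ... | no  j≰k = contradiction j≤k j≰k

  reflectAbove-> : ∀ {j} → k < j → reflectAbove n k j ≡ n + k ∸ j
  reflectAbove-> {j} k<j with j ≤? k
  ... | yes j≤k = contradiction j≤k (<⇒≱ k<j)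
  ... | no  _   = refl

  k<n+k∸j : ∀ {j} → j < n → k < n + k ∸ j
  k<n+k∸j {j} j<n = m+n≤o⇒m≤o∸n (suc k) (≤-trans (+-monoʳ-< k j<n) (≤-reflexive (+-comm k n)))

  reflectAbove-< : ∀ {j} → j < n → reflectAbove n k j < n
  reflectAbove-< {j} j<n with j ≤? k
  ... | yes _   = j<n
  ... | no  j≰k = subst (n + k ∸ j <_) (m+n∸n≡m n k)
                    (∸-monoʳ-< (≰⇒> j≰k) (≤-trans (<⇒≤ j<n) (m≤m+n n k)))

  reflectAbove-involutive : ∀ {j} → j < n → reflectAbove n k (reflectAbove n k j) ≡ j
  reflectAbove-involutive {j} j<n with j ≤? k
  ... | yes j≤k = reflectAbove-≤ j≤k
  ... | no  j≰k = begin
    reflectAbove n k (n + k ∸ j) ≡⟨ reflectAbove-> (k<n+k∸j j<n) ⟩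
    n + k ∸ (n + k ∸ j)          ≡⟨ m∸[m∸n]≡n (≤-trans (<⇒≤ j<n) (m≤m+n n k)) ⟩
    j                            ∎
    where open ≡-Reasoning

transpose-sends : ∀ {s} (a b : Fin s) → transpose a b a ≡ b
transpose-sends a b rewrite dec-true (a ≟ᶠ a) refl = refl

transpose-fixes : ∀ {s} (a b j : Fin s) → j ≢ a → j ≢ b → transpose a b j ≡ j
transpose-fixes a b j j≢a j≢b rewrite dec-false (j ≟ᶠ a) j≢a | dec-false (j ≟ᶠ b) j≢b = refl

transpose-injective : ∀ {s} (a b : Fin s) → Injective _≡_ _≡_ (transpose a b)
transpose-injective a b {x} {y} e = begin
  x                               ≡⟨ sym (transpose-inverse b a) ⟩
  transpose b a (transpose a b x) ≡⟨ cong (transpose b a) e ⟩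
  transpose b a (transpose a b y) ≡⟨ transpose-inverse b a ⟩
  y                               ∎
  where open ≡-Reasoning

-- The tuple of (0-based) points 0, 1, …, k, n-1, n-2, … : swapping its positions k and k+i+1
-- moves the point k to n-i-1 and leaves the first k and the last i points
-- in place.
reflectTuple : ∀ {s n} (k : ℕ) → s ≤ n → Fin s → Fin n
reflectTuple k s≤n j = fromℕ< (reflectAbove-< {k = k} (<-≤-trans (toℕ<n j) s≤n))

module _ {s n : ℕ} (k : ℕ) (s≤n : s ≤ n) where

  toℕ-reflectTuple : ∀ j → toℕ (reflectTuple k s≤n j) ≡ reflectAbove n k (toℕ j)
  toℕ-reflectTuple j = toℕ-fromℕ< _

  reflectTuple-injective : Injective _≡_ _≡_ (reflectTuple k s≤n)
  reflectTuple-injective {a} {b} e = toℕ-injective (begin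
    toℕ a                                      ≡⟨ sym (reflectAbove-involutive (<-≤-trans (toℕ<n a) s≤n)) ⟩
    reflectAbove n k (reflectAbove n k (toℕ a)) ≡⟨ cong (reflectAbove n k) reflect-a≡reflect-b ⟩
    reflectAbove n k (reflectAbove n k (toℕ b)) ≡⟨ reflectAbove-involutive (<-≤-trans (toℕ<n b) s≤n) ⟩
    toℕ b                                      ∎)
    where
    open ≡-Reasoning
    reflect-a≡reflect-b : reflectAbove n k (toℕ a) ≡ reflectAbove n k (toℕ b)
    reflect-a≡reflect-b = trans (sym (toℕ-reflectTuple a)) (trans (cong toℕ e) (toℕ-reflectTuple b))

module Conjugation {c ℓ : Level} (G : Group c ℓ) where
  open Group G renaming (refl to ≈-refl; sym to ≈-sym)
  open SetoidReasoning setoid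

  conj : Carrier → Carrier → Carrier
  conj g h = (g ⁻¹ ∙ h) ∙ g

  conj-cong : ∀ {g g′ h h′} → g ≈ g′ → h ≈ h′ → conj g h ≈ conj g′ h′
  conj-cong g≈g′ h≈h′ = ∙-cong (∙-cong (⁻¹-cong g≈g′) h≈h′) g≈g′

  conj-homo : ∀ g x y → conj g (x ∙ y) ≈ conj g x ∙ conj g y
  conj-homo g x y = begin
    conj g (x ∙ y)                         ≈⟨ solve monoid ⟩
    (g ⁻¹ ∙ x) ∙ (ε ∙ (y ∙ g))             ≈⟨ ∙-congˡ (∙-congʳ (≈-sym (inverseʳ g))) ⟩
    (g ⁻¹ ∙ x) ∙ ((g ∙ g ⁻¹) ∙ (y ∙ g))   ≈⟨ solve monoid ⟩
    conj g x ∙ conj g y                    ∎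

  conj-ε : ∀ h → conj ε h ≈ h
  conj-ε h = begin
    (ε ⁻¹ ∙ h) ∙ ε ≈⟨ ∙-congʳ (∙-congʳ (ε⁻¹≈ε G)) ⟩
    (ε ∙ h) ∙ ε    ≈⟨ solve monoid ⟩
    h              ∎

  conj-∙ : ∀ g g′ h → conj g (conj g′ h) ≈ conj (g′ ∙ g) h
  conj-∙ g g′ h = begin
    conj g (conj g′ h)               ≈⟨ solve monoid ⟩
    ((g ⁻¹ ∙ g′ ⁻¹) ∙ h) ∙ (g′ ∙ g) ≈⟨ ∙-congʳ (∙-congʳ (≈-sym (⁻¹-anti-homo-∙ G g′ g))) ⟩
    conj (g′ ∙ g) h                  ∎

  conj-inverseˡ : ∀ g h → conj (g ⁻¹) (conj g h) ≈ h
  conj-inverseˡ g h = begin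
    conj (g ⁻¹) (conj g h) ≈⟨ conj-∙ (g ⁻¹) g h ⟩
    conj (g ∙ g ⁻¹) h      ≈⟨ conj-cong (inverseʳ g) ≈-refl ⟩
    conj ε h               ≈⟨ conj-ε h ⟩
    h                      ∎

  conj-inverseʳ : ∀ g h → conj g (conj (g ⁻¹) h) ≈ h
  conj-inverseʳ g h = begin
    conj g (conj (g ⁻¹) h) ≈⟨ conj-∙ g (g ⁻¹) h ⟩
    conj (g ⁻¹ ∙ g) h      ≈⟨ conj-cong (inverseˡ g) ≈-refl ⟩
    conj ε h               ≈⟨ conj-ε h ⟩
    h                      ∎

module _ {c ℓ : Level} (Γ : Group c ℓ) (n : ℕ) where
  open Group Γ renaming (refl to ≈-refl; sym to ≈-sym; trans to ≈-trans)
  open GroupAction Γ n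
  open Conjugation Γ
  open SetoidReasoning setoid

  conj-CayIso : ∀ {q₁ p₁ q₂ p₂} {Δ₁ : Pred Carrier q₁} {S₁ : Pred Carrier p₁}
                {Δ₂ : Pred Carrier q₂} {S₂ : Pred Carrier p₂} (g : Carrier) →
                Δ₂ Respects _≈_ → S₂ Respects _≈_ →
                Δ₁ ≐ Δ₂ ∘ conj g → S₁ ≐ S₂ ∘ conj g →
                CayIso Δ₁ S₁ Δ₂ S₂
  conj-CayIso {Δ₁ = Δ₁} {S₁} {Δ₂} {S₂} g Δ₂-resp S₂-resp (Δ₁⊆ , ⊆Δ₁) (S₁⊆ , ⊆S₁) = record
    { to        = λ (x , x∈Δ₁) → conj g x , Δ₁⊆ x∈Δ₁
    ; from      = λ (y , y∈Δ₂) → conj (g ⁻¹) y , ⊆Δ₁ (Δ₂-resp (≈-sym (conj-inverseʳ g y)) y∈Δ₂)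
    ; to-cong   = λ _ _ → conj-cong ≈-refl
    ; from-cong = λ _ _ → conj-cong ≈-refl
    ; from-to   = λ (x , _) → conj-inverseˡ g x
    ; to-from   = λ (y , _) → conj-inverseʳ g y
    ; adj-to    = λ (x , _) (y , _) → Sum.map edge-to edge-to
    ; adj-from  = λ (x , _) (y , _) → Sum.map (edge-from x y) (edge-from y x)
    }
    where
    Edge : ∀ {p} → Pred Carrier p → Carrier → Carrier → Set (c ⊔ ℓ ⊔ p)
    Edge S x y = Σ Carrier λ s → S s × (y ≈ s ∙ x)

    edge-to : ∀ {x y} → Edge S₁ x y → Edge S₂ (conj g x) (conj g y)
    edge-to {x} {y} (s , s∈S₁ , y≈sx) =
      conj g s , S₁⊆ s∈S₁ , ≈-trans (conj-cong ≈-refl y≈sx) (conj-homo g s x)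

    edge-from : ∀ x y → Edge S₂ (conj g x) (conj g y) → Edge S₁ x y
    edge-from x y (s , s∈S₂ , gy≈sgx) =
      conj (g ⁻¹) s , ⊆S₁ (S₂-resp (≈-sym (conj-inverseʳ g s)) s∈S₂) , (begin
        y                                          ≈⟨ conj-inverseˡ g y ⟨
        conj (g ⁻¹) (conj g y)                     ≈⟨ conj-cong ≈-refl gy≈sgx ⟩
        conj (g ⁻¹) (s ∙ conj g x)                 ≈⟨ conj-homo (g ⁻¹) s (conj g x) ⟩
        conj (g ⁻¹) s ∙ conj (g ⁻¹) (conj g x)     ≈⟨ ∙-congˡ (conj-inverseˡ g x) ⟩
        conj (g ⁻¹) s ∙ x                          ∎)

module _ {c ℓ : Level} {Γ : Group c ℓ} {n : ℕ} (A : GroupAction.RightAction Γ n) where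
  open Group Γ renaming (refl to ≈-refl; sym to ≈-sym; trans to ≈-trans)
  open GroupAction Γ n
  open RightAction A
  open WithAction A
  open Conjugation Γ

  act-inverseʳ : ∀ g x → act (act x g) (g ⁻¹) ≡ x
  act-inverseʳ g x = trans (sym (act-∙ x g (g ⁻¹))) (trans (act-cong x (inverseʳ g)) (act-ε x))

  act-injective : ∀ g {x y} → act x g ≡ act y g → x ≡ y
  act-injective g {x} {y} e =
    trans (sym (act-inverseʳ g x)) (trans (cong (λ z → act z (g ⁻¹)) e) (act-inverseʳ g y))

  act-conj : ∀ g h y → act (act y g) (conj g h) ≡ act (act y h) g
  act-conj g h y = begin
    act (act y g) ((g ⁻¹ ∙ h) ∙ g)             ≡⟨ act-∙ (act y g) (g ⁻¹ ∙ h) g ⟩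
    act (act (act y g) (g ⁻¹ ∙ h)) g           ≡⟨ cong (λ z → act z g) (act-∙ (act y g) (g ⁻¹) h) ⟩
    act (act (act (act y g) (g ⁻¹)) h) g       ≡⟨ cong (λ z → act (act z h) g) (act-inverseʳ g y) ⟩
    act (act y h) g                            ∎
    where open ≡-Reasoning

  fixes-transport : ∀ {g h x y} → act y g ≡ x → (act y h ≡ y ⇔ act x (conj g h) ≡ x)
  fixes-transport {g} {h} {y = y} refl = mk⇔
    (λ hy≡y → trans (act-conj g h y) (cong (λ z → act z g) hy≡y))
    (λ e → act-injective g (trans (sym (act-conj g h y)) e))

  Γsup-respects : ∀ i → Γsup i Respects _≈_
  Γsup-respects i h≈h′ fixes x p = trans (act-cong x (≈-sym h≈h′)) (fixes x p)

  Tk-respects : ∀ {p} {T : Pred Carrier p} k → T Respects _≈_ → Tk T k Respects _≈_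
  Tk-respects k T-resp h≈h′ (τ∈T , moves) =
    T-resp h≈h′ τ∈T , λ x p e → moves x p (trans (act-cong x h≈h′) e)

  conj-invariant : ∀ {p} {T : Pred Carrier p} g → IsSymConjGenSet T → T ≐ T ∘ conj g
  conj-invariant g T-gen =
    conj-closed g , (λ τ′∈T → resp (conj-inverseˡ g _) (conj-closed (g ⁻¹) τ′∈T))
    where open IsSymConjGenSet T-gen renaming (conj to conj-closed)

  Tk-conj-invariant : ∀ {p} {T : Pred Carrier p} {k g} → IsSymConjGenSet T →
                      (∀ x → toℕ x < k → act x g ≡ x) → Tk T k ≐ Tk T k ∘ conj g
  Tk-conj-invariant {T = T} {k} {g} T-gen fixes-init =
    (λ (τ∈T , moves) → proj₁ T≐ τ∈T , λ x p → moves x p ∘ from (transport x p)) ,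
    (λ (τ∈T , moves) → proj₂ T≐ τ∈T , λ x p → moves x p ∘ to (transport x p))
    where
    T≐ : T ≐ T ∘ conj g
    T≐ = conj-invariant g T-gen
    transport : ∀ {h} x → toℕ x < k → (act x h ≡ x ⇔ act x (conj g h) ≡ x)
    transport x p = fixes-transport (fixes-init x p)

  record Transfers (k i : ℕ) (g : Carrier) : Set where
    field
      fixes-init : ∀ x → toℕ x < k → act x g ≡ x
      fixes-last : ∀ x → n ∸ i ≤ toℕ x → act x g ≡ x
      source     : Fin n
      target     : Fin n
      toℕ-source : toℕ source ≡ k
      toℕ-target : toℕ target ≡ n ∸ suc i
      sends      : act source g ≡ target

  module _ {k i : ℕ} {g : Carrier} (t : Transfers k i g) where
    open Transfers t

    Γsup∩StabPt-conj : Γsup i ∩ StabPt k ≐ Γsup (suc i) ∘ conj g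
    Γsup∩StabPt-conj = to-Γsup , from-Γsup
      where
      is-source : ∀ x → toℕ x ≡ k → x ≡ source
      is-source x e = toℕ-injective (trans e (sym toℕ-source))

      is-target : ∀ x → toℕ x ≡ n ∸ suc i → x ≡ target
      is-target x e = toℕ-injective (trans e (sym toℕ-target))

      to-Γsup : Γsup i ∩ StabPt k ⊆ Γsup (suc i) ∘ conj g
      to-Γsup (fix-last , fix-k) x p with ∸-suc-≤-split n i p
      ... | inj₁ q = to (fixes-transport (fixes-last x q)) (fix-last x q)
      ... | inj₂ e rewrite is-target x e =
        to (fixes-transport sends) (fix-k source toℕ-source)

      from-Γsup : Γsup (suc i) ∘ conj g ⊆ Γsup i ∩ StabPt k
      from-Γsup fix = (λ x p → from (fixes-transport (fixes-last x p)) (fix x (≤-trans (∸-monoʳ-≤ n (n≤1+n i)) p)))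
                    , (λ x e → subst (λ y → act y _ ≡ y) (sym (is-source x e))
                         (from (fixes-transport sends) (fix target (≤-reflexive (sym toℕ-target)))))

    transfers⇒H≅G : ∀ {p} {T : Pred Carrier p} → IsSymConjGenSet T → H≅G T k i k (suc i)
    transfers⇒H≅G {T = T} T-gen = conj-CayIso Γ n g
      (Γsup-respects (suc i))
      (λ h≈h′ (τ∈Tk , fix) → Tk-respects k resp h≈h′ τ∈Tk , Γsup-respects (suc i) h≈h′ fix)
      Γsup∩StabPt-conj
      ( (λ ((τ∈Tk , fix-k) , fix-last) → proj₁ Tk≐ τ∈Tk , proj₁ Γsup∩StabPt-conj (fix-last , fix-k))
      , (λ (τ∈Tk , fix) → let (fix-last , fix-k) = proj₂ Γsup∩StabPt-conj fix
                          in (proj₂ Tk≐ τ∈Tk , fix-k) , fix-last))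
      where
      open IsSymConjGenSet T-gen using (resp)
      Tk≐ : Tk T k ≐ Tk T k ∘ conj g
      Tk≐ = Tk-conj-invariant T-gen fixes-init

  transposition-realised : ∀ {s} → Transitive s →
    (u : Fin s → Fin n) → Injective _≡_ _≡_ u → (a b : Fin s) →
    Σ Carrier λ g → act (u a) g ≡ u b × (∀ j → j ≢ a → j ≢ b → act (u j) g ≡ u j)
  transposition-realised (_ , transitive) u u-inj a b
    with transitive u (u ∘ transpose a b) u-inj (λ e → transpose-injective a b (u-inj e))
  ... | g , maps = g , trans (maps a) (cong u (transpose-sends a b))
                     , λ j j≢a j≢b → trans (maps j) (cong u (transpose-fixes a b j j≢a j≢b))

  module _ {s : ℕ} (k i : ℕ) (transitive : Transitive s) (k+1+i<s : k + suc i < s) where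
    private
      s≤n : s ≤ n
      s≤n = proj₁ transitive

      k<k+1+i : k < k + suc i
      k<k+1+i = m<m+n k z<s

      k<s : k < s
      k<s = <-trans k<k+1+i k+1+i<s

      u : Fin s → Fin n
      u = reflectTuple k s≤n

      kF JF : Fin s
      kF = fromℕ< k<s
      JF = fromℕ< k+1+i<s

      swap : Σ Carrier λ g → act (u kF) g ≡ u JF × (∀ j → j ≢ kF → j ≢ JF → act (u j) g ≡ u j)
      swap = transposition-realised transitive u (reflectTuple-injective k s≤n) kF JF

      g : Carrier
      g = proj₁ swap

      position-≢ : ∀ {r} (r<s : r < s) {q} (q<s : q < s) → r ≢ q → fromℕ< r<s ≢ fromℕ< q<s
      position-≢ r<s q<s r≢q e = r≢q (trans (sym (toℕ-fromℕ< r<s)) (trans (cong toℕ e) (toℕ-fromℕ< q<s)))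

      fixed-at-position : ∀ x {r} → reflectAbove n k (toℕ x) ≡ r → (r<s : r < s) →
                          r ≢ k → r ≢ k + suc i → act x g ≡ x
      fixed-at-position x {r} e r<s r≢k r≢k+1+i =
        subst (λ y → act y g ≡ y) u[r]≡x
          (proj₂ (proj₂ swap) (fromℕ< r<s) (position-≢ r<s k<s r≢k) (position-≢ r<s k+1+i<s r≢k+1+i))
        where
        u[r]≡x : u (fromℕ< r<s) ≡ x
        u[r]≡x = toℕ-injective (begin
          toℕ (u (fromℕ< r<s))                        ≡⟨ toℕ-reflectTuple k s≤n (fromℕ< r<s) ⟩
          reflectAbove n k (toℕ (fromℕ< r<s))          ≡⟨ cong (reflectAbove n k) (toℕ-fromℕ< r<s) ⟩
          reflectAbove n k r                          ≡⟨ cong (reflectAbove n k) e ⟨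
          reflectAbove n k (reflectAbove n k (toℕ x)) ≡⟨ reflectAbove-involutive (toℕ<n x) ⟩
          toℕ x                                       ∎)
          where open ≡-Reasoning

      g-fixes-init : ∀ x → toℕ x < k → act x g ≡ x
      g-fixes-init x x<k = fixed-at-position x (reflectAbove-≤ (<⇒≤ x<k)) (<-trans x<k k<s)
                             (<⇒≢ x<k) (<⇒≢ (<-trans x<k k<k+1+i))

      g-fixes-last : ∀ x → n ∸ i ≤ toℕ x → act x g ≡ x
      g-fixes-last x p = fixed-at-position x (reflectAbove-> k<x) (<-trans r<k+1+i k+1+i<s)
                           (≢-sym (<⇒≢ k<r)) (<⇒≢ r<k+1+i)
        where
        k<x : k < toℕ x
        k<x = <-≤-trans (m+suc[n]≤o⇒m<o∸n k i (<⇒≤ (<-≤-trans k+1+i<s s≤n))) p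

        k<r : k < n + k ∸ toℕ x
        k<r = k<n+k∸j (toℕ<n x)

        r<k+1+i : n + k ∸ toℕ x < k + suc i
        r<k+1+i = ≤-<-trans (m∸n≤o⇒m+p∸o≤p+n n i (toℕ x) k p) (+-monoʳ-< k (n<1+n i))

    transitive⇒transfers : Σ Carrier (Transfers k i)
    transitive⇒transfers = g , record
      { fixes-init = g-fixes-init
      ; fixes-last = g-fixes-last
      ; source = u kF
      ; target = u JF
      ; toℕ-source = begin
          toℕ (u kF)                             ≡⟨ toℕ-reflectTuple k s≤n kF ⟩
          reflectAbove n k (toℕ (fromℕ< k<s))    ≡⟨ cong (reflectAbove n k) (toℕ-fromℕ< k<s) ⟩
          reflectAbove n k k                    ≡⟨ reflectAbove-≤ ≤-refl ⟩
          k                                     ∎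
      ; toℕ-target = begin
          toℕ (u JF)                             ≡⟨ toℕ-reflectTuple k s≤n JF ⟩
          reflectAbove n k (toℕ (fromℕ< k+1+i<s)) ≡⟨ cong (reflectAbove n k) (toℕ-fromℕ< k+1+i<s) ⟩
          reflectAbove n k (k + suc i)           ≡⟨ reflectAbove-> k<k+1+i ⟩
          n + k ∸ (k + suc i)                    ≡⟨ cong (_∸ (k + suc i)) (+-comm n k) ⟩
          k + n ∸ (k + suc i)                    ≡⟨ [m+n]∸[m+o]≡n∸o k n (suc i) ⟩
          n ∸ suc i                              ∎
      ; sends = proj₁ (proj₂ swap)
      }
      where open ≡-Reasoning

lemma3p4 : ∀ {c ℓ p : Level} (Γ : Group c ℓ) (n : ℕ)
    (A : GroupAction.RightAction Γ n) (T : Pred (Group.Carrier Γ) p) (m a : ℕ) →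
    GroupAction.Finite Γ n →
    GroupAction.IsSymConjGenSet Γ n T →
    GroupAction.WithAction.IsMaxSupp Γ n A T m →
    2 ≤ a →
    GroupAction.WithAction.Transitive Γ n A (m + a) →
    ∀ (i k : ℕ) → i + 2 ≤ a → suc k ≤ m →
    GroupAction.WithAction.H≅G Γ n A T k i k (suc i)
lemma3p4 Γ n A T m a _ T-gen _ _ transitive i k i+2≤a k<m =
  transfers⇒H≅G A (proj₂ (transitive⇒transfers A k i transitive k+1+i<m+a)) T-gen
  where
  k+1+i<m+a : k + suc i < m + a
  k+1+i<m+a = +-mono-≤ k<m (≤-trans (n≤1+n (suc i)) (≤-trans (≤-reflexive (+-comm 2 i)) i+2≤a))
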